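{- If $\beta$ is an infinitary proof translation, then $\mathrm{trans}_\beta$ maps every finite proof in $\mathrm{i}\mathsf{GL}_{\mathrm{Seq}}$ to a proof in $\mathrm{i}\mathsf{K4}_\infty$.
   Context: Formulas are built from propositional variables and $\bot$ with $\to,\wedge,\vee,\Box$; a sequent $\Gamma\Rightarrow\phi$ is a finite multiset $\Gamma$ of formulas and one formula $\phi$; $\Box\Gamma=\{\Box\psi:\psi\in\Gamma\}$. The rule set $\mathrm{i}\mathsf{G3}$: Prop: $\Gamma,p\Rightarrow p$; Absurd: $\Gamma,\bot\Rightarrow\phi$; $(\wedge L)$: $\Gamma,\phi,\psi\Rightarrow\chi$ / $\Gamma,\phi\wedge\psi\Rightarrow\chi$; $(\wedge R)$: $\Gamma\Rightarrow\phi$, $\Gamma\Rightarrow\psi$ / $\Gamma\Rightarrow\phi\wedge\psi$; $(\vee L)$: $\Gamma,\phi\Rightarrow\chi$, $\Gamma,\psi\Rightarrow\chi$ / $\Gamma,\phi\vee\psi\Rightarrow\chi$; $(\vee R_0)$: $\Gamma\Rightarrow\phi$ / $\Gamma\Rightarrow\phi\vee\psi$; $(\vee R_1)$: $\Gamma\Rightarrow\psi$ / $\Gamma\Rightarrow\phi\vee\psi$; $(\to L)$: $\Gamma,\phi\to\psi\Rightarrow\phi$, $\Gamma,\psi\Rightarrow\chi$ / $\Gamma,\phi\to\psi\Rightarrow\chi$; $(\to R)$: $\Gamma,\phi\Rightarrow\psi$ / $\Gamma\Rightarrow\phi\to\psi$. $\mathrm{i}\mathsf{GL}_{\mathrm{Seq}}=\mathrm{i}\mathsf{G3}+\mathrm{R}_{\mathsf{GL}}$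 where $\mathrm{R}_{\mathsf{GL}}$: $\Gamma,\Box\Gamma,\Box\phi\Rightarrow\phi$ / $\Pi,\Box\Gamma\Rightarrow\Box\phi$; $\mathrm{i}\mathsf{K4}_{\mathrm{Seq}}=\mathrm{i}\mathsf{G3}+\mathrm{R}_{\mathsf{K4}}$ where $\mathrm{R}_{\mathsf{K4}}$: $\Gamma,\Box\Gamma\Rightarrow\phi$ / $\Pi,\Box\Gamma\Rightarrow\Box\phi$. Tree denotes the set of (possibly infinite) finitely branching rooted trees with ordered children and node labels in $\mathrm{Sequent}\times\mathrm{RulName}$ (the final coalgebra of $X\mapsto(\mathrm{Sequent}\times\mathrm{RulName})\times X^*$); FinTree is the set of finite ones; $\mathrm{node}(a,[t_0,\dots,t_{n-1}])$ is the tree with root label $a$ and ordered immediate subtrees $t_i$. A branch of a tree is an infinite path from the root. A finite proof in a rule set $R$ is a finite tree in which at each node, (children's sequents in order, the node's sequent, the node's rule name) is an instance of a rule of $R$; the height of a finite tree is the length of its longest path from the root. A proof in $\mathrm{i}\mathsf{K4}_\infty$ is a tree in Tree such that at every node, (children's sequents, node's sequent, node's rule name) is an instance of a rule of $\mathrm{i}\mathsf{K4}_{\mathrm{Seq}}$, and every branch contains infinitely many nodes whose rule name is $\mathrm{R}_{\mathsf{K4}}$. An infinitary proof translation is a function $\beta:\mathrm{FinTree}\to(\mathrm{Sequent}\times\mathrm{RulName})\times\mathrm{FinTree}^*$ such that for every finite proof $\pi$ in $\mathrm{i}\mathsf{GL}_{\mathrm{Seq}}$, writing $\beta(\pi)=((S,L),[\iota_0,\dots,\iota_{n-1}])$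 and letting $(S_i,L_i)$ be the first component of $\beta(\iota_i)$: (1) each $\iota_i$ is a finite proof in $\mathrm{i}\mathsf{GL}_{\mathrm{Seq}}$; (2) $S_0,\dots,S_{n-1}$ / $S$ with name $L$ is an instance of a rule of $\mathrm{i}\mathsf{K4}_{\mathrm{Seq}}$; (3) if $L\neq\mathrm{R}_{\mathsf{K4}}$ then $\mathrm{height}(\iota_i)<\mathrm{height}(\pi)$ for all $i$. Given such $\beta$, $\mathrm{trans}_\beta:\mathrm{FinTree}\to\mathrm{Tree}$ is the unique function with $\mathrm{trans}_\beta(t)=\mathrm{node}(a,[\mathrm{trans}_\beta(t_0),\dots,\mathrm{trans}_\beta(t_{n-1})])$ whenever $\beta(t)=(a,[t_0,\dots,t_{n-1}])$. -}

module Defs where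

open import Data.Nat using (ℕ; zero; suc; _≤_; _<_; _⊔_)
open import Data.Fin using (Fin; toℕ)
open import Data.Unit using (⊤)
open import Data.List using (List; []; _∷_; _++_; map; length; lookup; tabulate)
open import Data.List.Relation.Unary.All using (All)
open import Data.List.Relation.Binary.Permutation.Propositional using (_↭_)
open import Data.List.Relation.Binary.Pointwise using (Pointwise)
open import Data.Product using (Σ; ∃; _×_; _,_; proj₁; proj₂)
open import Relation.Binary.PropositionalEquality using (_≡_; _≢_)

infixr 6 _⇒'_
infixr 7 _∨'_
infixr 8 _∧'_

data Fm : Set where
  var  : ℕ → Fm
  ⊥'   : Fm
  _⇒'_ : Fm → Fm → Fm
  _∧'_ : Fm → Fm → Fm
  _∨'_ : Fm → Fm → Fm
  □    : Fm → Fm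

-- A sequent Γ ⇒ φ; the antecedent is a multiset, represented by a list
-- considered up to permutation (see _≈S_ below).
record Sequent : Set where
  constructor _⊢_
  field
    ante : List Fm
    succ : Fm
open Sequent public

infix 4 _⊢_

□s : List Fm → List Fm
□s Γ = map □ Γ

_≈S_ : Sequent → Sequent → Set
(Γ ⊢ φ) ≈S (Δ ⊢ ψ) = (Γ ↭ Δ) × (φ ≡ ψ)

data RulName : Set where
  Prop Absurd AndL AndR OrL OrR0 OrR1 ImpL ImpR R-GL R-K4 : RulName

data G3Raw : List Sequent → Sequent → RulName → Set where
  prop   : ∀ {Γ p} → G3Raw [] (var p ∷ Γ ⊢ var p) Prop
  absurd : ∀ {Γ φ} → G3Raw [] (⊥' ∷ Γ ⊢ φ) Absurd
  andL   : ∀ {Γ φ ψ χ} → G3Raw ((φ ∷ ψ ∷ Γ ⊢ χ) ∷ []) ((φ ∧' ψ) ∷ Γ ⊢ χ) AndL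
  andR   : ∀ {Γ φ ψ} → G3Raw ((Γ ⊢ φ) ∷ (Γ ⊢ ψ) ∷ []) (Γ ⊢ φ ∧' ψ) AndR
  orL    : ∀ {Γ φ ψ χ} → G3Raw ((φ ∷ Γ ⊢ χ) ∷ (ψ ∷ Γ ⊢ χ) ∷ []) ((φ ∨' ψ) ∷ Γ ⊢ χ) OrL
  orR0   : ∀ {Γ φ ψ} → G3Raw ((Γ ⊢ φ) ∷ []) (Γ ⊢ φ ∨' ψ) OrR0
  orR1   : ∀ {Γ φ ψ} → G3Raw ((Γ ⊢ ψ) ∷ []) (Γ ⊢ φ ∨' ψ) OrR1
  impL   : ∀ {Γ φ ψ χ} →
           G3Raw (((φ ⇒' ψ) ∷ Γ ⊢ φ) ∷ (ψ ∷ Γ ⊢ χ) ∷ []) ((φ ⇒' ψ) ∷ Γ ⊢ χ) ImpL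
  impR   : ∀ {Γ φ ψ} → G3Raw ((φ ∷ Γ ⊢ ψ) ∷ []) (Γ ⊢ φ ⇒' ψ) ImpR

data GLRaw : List Sequent → Sequent → RulName → Set where
  g3  : ∀ {ps s L} → G3Raw ps s L → GLRaw ps s L
  rGL : ∀ {Γ Π φ} →
        GLRaw ((Γ ++ □s Γ ++ (□ φ ∷ []) ⊢ φ) ∷ []) (Π ++ □s Γ ⊢ □ φ) R-GL

data K4Raw : List Sequent → Sequent → RulName → Set where
  g3  : ∀ {ps s L} → G3Raw ps s L → K4Raw ps s L
  rK4 : ∀ {Γ Π φ} →
        K4Raw ((Γ ++ □s Γ ⊢ φ) ∷ []) (Π ++ □s Γ ⊢ □ φ) R-K4

UpToMS : (List Sequent → Sequent → RulName → Set) →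
         List Sequent → Sequent → RulName → Set
UpToMS R ps s L =
  Σ (List Sequent) λ ps' → Σ Sequent λ s' →
    Pointwise _≈S_ ps ps' × s ≈S s' × R ps' s' L

GLInst K4Inst : List Sequent → Sequent → RulName → Set
GLInst = UpToMS GLRaw
K4Inst = UpToMS K4Raw

Label : Set
Label = Sequent × RulName

data FinTree : Set where
  fnode : Label → List FinTree → FinTree

rootLabel : FinTree → Label
rootLabel (fnode a _) = a

rootSeq : FinTree → Sequent
rootSeq t = proj₁ (rootLabel t)

mutual
  height : FinTree → ℕ
  height (fnode _ []) = 0
  height (fnode _ (t ∷ ts)) = suc (heights (t ∷ ts))

  heights : List FinTree → ℕ
  heights [] = 0
  heights (t ∷ ts) = height t ⊔ heights ts

data GLProof : FinTree → Set where
  glnode : ∀ {S L ts} →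
           GLInst (map rootSeq ts) S L →
           All GLProof ts →
           GLProof (fnode (S , L) ts)

-- Possibly infinite finitely branching ordered trees.
-- (--guardedness is unavailable, so the final coalgebra of
-- X ↦ Label × X* is represented by its position-indexed description:
-- a position is a list of child indices from the root; a tree gives a
-- label and a number of children at every position. Only values at
-- valid positions (ValidPos) matter; everything below only inspects those.)

record Tree : Set where
  constructor mkTree
  field
    labelAt : List ℕ → Label
    arityAt : List ℕ → ℕ
open Tree public

label : Tree → Label
label t = labelAt t []

arity : Tree → ℕ
arity t = arityAt t []

child : Tree → ℕ → Tree
child t i = mkTree (λ p → labelAt t (i ∷ p)) (λ p → arityAt t (i ∷ p))

subtree : Tree → List ℕ → Tree
subtree t [] = t
subtree t (i ∷ p) = subtree (child t i) p

ValidPos : Tree → List ℕ → Set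
ValidPos t [] = ⊤
ValidPos t (i ∷ p) = (i < arity t) × ValidPos (child t i) p

tseq : Tree → Sequent
tseq t = proj₁ (label t)

tname : Tree → RulName
tname t = proj₂ (label t)

childSeqs : Tree → List Sequent
childSeqs t = tabulate {n = arity t} (λ i → tseq (child t (toℕ i)))

AllNodes : (Tree → Set) → Tree → Set
AllNodes P t = ∀ p → ValidPos t p → P (subtree t p)

-- a branch: an infinite path from the root, given by the sequence of
-- child indices chosen; f n is the index chosen at depth n.
prefix : (ℕ → ℕ) → ℕ → List ℕ
prefix f zero = []
prefix f (suc n) = f 0 ∷ prefix (λ k → f (suc k)) n

IsBranch : Tree → (ℕ → ℕ) → Set
IsBranch t f = ∀ n → f n < arity (subtree t (prefix f n))

nodeAt : Tree → (ℕ → ℕ) → ℕ → Tree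
nodeAt t f n = subtree t (prefix f n)

InfManyK4 : Tree → (ℕ → ℕ) → Set
InfManyK4 t f = ∀ n → ∃ λ m → n ≤ m × tname (nodeAt t f m) ≡ R-K4

LocalK4 : Tree → Set
LocalK4 t = K4Inst (childSeqs t) (tseq t) (tname t)

IK4∞Proof : Tree → Set
IK4∞Proof t = AllNodes LocalK4 t × (∀ f → IsBranch t f → InfManyK4 t f)

BetaT : Set
BetaT = FinTree → Label × List FinTree

IsInfProofTranslation : BetaT → Set
IsInfProofTranslation β =
  ∀ π → GLProof π →
    All GLProof (proj₂ (β π)) ×
    K4Inst (map (λ ι → proj₁ (proj₁ (β ι))) (proj₂ (β π)))
           (proj₁ (proj₁ (β π))) (proj₂ (proj₁ (β π))) ×
    (proj₂ (proj₁ (β π)) ≢ R-K4 →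
       All (λ ι → height ι < height π) (proj₂ (β π)))

nthOr : {A : Set} → A → List A → ℕ → A
nthOr d [] i = d
nthOr d (x ∷ xs) zero = x
nthOr d (x ∷ xs) (suc i) = nthOr d xs i

reach : BetaT → FinTree → List ℕ → FinTree
reach β t [] = t
reach β t (i ∷ p) = reach β (nthOr t (proj₂ (β t)) i) p

-- trans_β: trans β t = node (a , [trans β t₀ , … , trans β tₙ₋₁])
-- where β t = (a , [t₀ , … , tₙ₋₁]); here definitionally
-- label (trans β t) = a, arity (trans β t) = n and
-- child (trans β t) i = trans β tᵢ for i < n.
trans : BetaT → FinTree → Tree
trans β t = mkTree (λ p → proj₁ (β (reach β t p)))
                   (λ p → length (proj₂ (β (reach β t p))))

module Submission where

-- Local correctness of trans β at a node is clause (2) of β at the finite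
-- proof that node comes from, and by clause (1) every such finite tree is
-- again an iGL_Seq proof. Along a branch the heights of these finite proofs
-- strictly decrease at every non-R_K4 node (clause (3)), so a run of
-- non-R_K4 nodes is no longer than the current height: R_K4 recurs forever.

open import Defs
open import Data.Nat using (ℕ; zero; suc; _≤_; _<_; s≤s; s≤s⁻¹)
open import Data.Nat.Properties using (≤-refl; ≤-trans; <-≤-trans; n≤1+n; n≮0)
open import Data.Fin using (toℕ)
open import Data.List using (List; []; _∷_; map; length; tabulate)
open import Data.List.Relation.Unary.All using (All; _∷_)
open import Data.Product using (∃; _×_; _,_; proj₁; proj₂)
open import Relation.Nullary using (¬_; Dec; yes; no; contradiction)
open import Relation.Binary.PropositionalEquality using (_≡_; _≢_; refl; sym; subst; cong) renaming (trans to ≡-trans)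

_≟R-K4 : (L : RulName) → Dec (L ≡ R-K4)
R-K4   ≟R-K4 = yes refl
Prop   ≟R-K4 = no λ ()
Absurd ≟R-K4 = no λ ()
AndL   ≟R-K4 = no λ ()
AndR   ≟R-K4 = no λ ()
OrL    ≟R-K4 = no λ ()
OrR0   ≟R-K4 = no λ ()
OrR1   ≟R-K4 = no λ ()
ImpL   ≟R-K4 = no λ ()
ImpR   ≟R-K4 = no λ ()
R-GL   ≟R-K4 = no λ ()

All-nthOr : {A : Set} {Q : A → Set} (d : A) {xs : List A} {i : ℕ} →
            All Q xs → i < length xs → Q (nthOr d xs i)
All-nthOr d {i = zero}  (q ∷ _)  _        = q
All-nthOr d {i = suc i} (_ ∷ qs) (s≤s i<) = All-nthOr d qs i<

tabulate-nthOr : {A B : Set} (f : A → B) (d : A) (xs : List A) →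
                 tabulate {n = length xs} (λ i → f (nthOr d xs (toℕ i))) ≡ map f xs
tabulate-nthOr f d []       = refl
tabulate-nthOr f d (x ∷ xs) = cong (f x ∷_) (tabulate-nthOr f d xs)

infinitelyOften-byDescent : {P : ℕ → Set} (h : ℕ → ℕ) → (∀ n → Dec (P n)) →
                            (∀ n → ¬ P n → h (suc n) < h n) →
                            ∀ n → ∃ λ m → n ≤ m × P m
infinitelyOften-byDescent {P} h P? descent n = search (h n) n ≤-refl
  where
  search : ∀ b n → h n ≤ b → ∃ λ m → n ≤ m × P m
  search b n hn≤b with P? n
  ... | yes Pn = n , ≤-refl , Pn
  search zero n hn≤0 | no ¬Pn = contradiction (<-≤-trans (descent n ¬Pn) hn≤0) n≮0
  search (suc b) n hn≤1+b | no ¬Pn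
    with search b (suc n) (s≤s⁻¹ (<-≤-trans (descent n ¬Pn) hn≤1+b))
  ... | m , 1+n≤m , Pm = m , ≤-trans (n≤1+n n) 1+n≤m , Pm

module _ (β : BetaT) where

  premises : FinTree → List FinTree
  premises t = proj₂ (β t)

  next : FinTree → ℕ → FinTree
  next t i = nthOr t (premises t) i

  subtree-trans : ∀ t p → subtree (trans β t) p ≡ trans β (reach β t p)
  subtree-trans t []      = refl
  subtree-trans t (i ∷ p) = subtree-trans (next t i) p

  reach-prefix-suc : ∀ t (f : ℕ → ℕ) n →
                     reach β t (prefix f (suc n)) ≡ next (reach β t (prefix f n)) (f n)
  reach-prefix-suc t f zero    = refl
  reach-prefix-suc t f (suc n) = reach-prefix-suc (next t (f 0)) (λ k → f (suc k)) n

  module _ (isβ : IsInfProofTranslation β) where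

    GLProof-next : ∀ {t i} → GLProof t → i < length (premises t) → GLProof (next t i)
    GLProof-next {t} ⊢t i< = All-nthOr t (proj₁ (isβ t ⊢t)) i<

    height-next : ∀ {t i} → GLProof t → proj₂ (proj₁ (β t)) ≢ R-K4 →
                  i < length (premises t) → height (next t i) < height t
    height-next {t} ⊢t ¬K4 i< = All-nthOr t (proj₂ (proj₂ (isβ t ⊢t)) ¬K4) i<

    GLProof-reach : ∀ {t} p → GLProof t → ValidPos (trans β t) p → GLProof (reach β t p)
    GLProof-reach []      ⊢t _          = ⊢t
    GLProof-reach (i ∷ p) ⊢t (i< , pos) = GLProof-reach p (GLProof-next ⊢t i<) pos

    LocalK4-trans : ∀ {t} → GLProof t → LocalK4 (trans β t)
    LocalK4-trans {t} ⊢t =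
      subst (λ ss → K4Inst ss (proj₁ (proj₁ (β t))) (proj₂ (proj₁ (β t))))
            (sym (tabulate-nthOr (λ ι → proj₁ (proj₁ (β ι))) t (premises t)))
            (proj₁ (proj₂ (isβ t ⊢t)))

    AllNodes-LocalK4-trans : ∀ {t} → GLProof t → AllNodes LocalK4 (trans β t)
    AllNodes-LocalK4-trans {t} ⊢t p pos =
      subst LocalK4 (sym (subtree-trans t p)) (LocalK4-trans (GLProof-reach p ⊢t pos))

    InfManyK4-trans : ∀ {t} → GLProof t → ∀ f → IsBranch (trans β t) f →
                      InfManyK4 (trans β t) f
    InfManyK4-trans {t} ⊢t f branch n =
      onTrans (infinitelyOften-byDescent (λ k → height (along k)) (λ k → ruleAlong k ≟R-K4)
                                         descent n)
      where
      along : ℕ → FinTree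
      along k = reach β t (prefix f k)

      ruleAlong : ℕ → RulName
      ruleAlong k = proj₂ (proj₁ (β (along k)))

      onBranch : ∀ k → f k < length (premises (along k))
      onBranch k = subst (λ T → f k < arity T) (subtree-trans t (prefix f k)) (branch k)

      GLProof-along : ∀ k → GLProof (along k)
      GLProof-along zero    = ⊢t
      GLProof-along (suc k) = subst GLProof (sym (reach-prefix-suc t f k))
                                    (GLProof-next (GLProof-along k) (onBranch k))

      descent : ∀ k → ruleAlong k ≢ R-K4 → height (along (suc k)) < height (along k)
      descent k ¬K4 = subst (λ T → height T < height (along k)) (sym (reach-prefix-suc t f k))
                            (height-next (GLProof-along k) ¬K4 (onBranch k))

      onTrans : (∃ λ m → n ≤ m × ruleAlong m ≡ R-K4) →
                ∃ λ m → n ≤ m × tname (nodeAt (trans β t) f m) ≡ R-K4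
      onTrans (m , n≤m , K4) = m , n≤m , ≡-trans (cong tname (subtree-trans t (prefix f m))) K4

mainTheorem3 : (β : BetaT) → IsInfProofTranslation β →
               (π : FinTree) → GLProof π → IK4∞Proof (trans β π)
mainTheorem3 β isβ π ⊢π = AllNodes-LocalK4-trans β isβ ⊢π , InfManyK4-trans β isβ ⊢π
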